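{- With probability tending to 1 as $n\to\infty$, the random graph $G=G_{n,1/2}$ has the following property: there exists a graph $H$ on the same vertex set $V=V(G)$, not isomorphic to $G$, such that $C^2_G(x)=C^2_H(x)$ for every vertex $x\in V$.
   Context: $G_{n,1/2}$ is the random graph on $n$ labelled vertices with each pair adjacent independently with probability $1/2$. For a graph $G$, colour refinement defines $C^0_G(v)=1$ for all $v$ and $C^{i}_G(v)=\big(C^{i-1}_G(v),\{\!\{C^{i-1}_G(w):w\in N(v)\}\!\}\big)$, where $\{\!\{\cdot\}\!\}$ denotes a multiset and $N(v)$ the neighbourhood; colours are formal objects, so colours in different graphs can be compared. -}

module Defs where

open import Data.Nat using (ℕ; zero; suc)
open import Data.Bool using (Bool; true; false)
open import Data.Fin using (Fin; zero; suc)
open import Data.Fin.Permutation using (Permutation′; _⟨$⟩ʳ_)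
open import Data.Vec using (Vec; lookup)
open import Data.List using (List; []; _∷_; map; filter)
open import Data.List.Relation.Binary.Permutation.Homogeneous using (Permutation)
open import Data.Product using (_×_; _,_)
open import Data.Bool using (T)
open import Relation.Nullary.Decidable using (T?)
open import Relation.Binary.PropositionalEquality using (_≡_)

-- Labelled simple graphs on vertex set Fin n, encoded so that there are
-- exactly 2^(n choose 2) of them and ≡ is graph equality:
-- a graph on Fin (suc n) is (adjacency of vertex zero to each vertex suc j, graph on the rest).
Graph : ℕ → Set
Graph zero = Data.Unit.⊤ where import Data.Unit
Graph (suc n) = Vec Bool n × Graph n

adj : ∀ {n} → Graph n → Fin n → Fin n → Bool
adj {suc n} (r , g) zero    zero    = false
adj {suc n} (r , g) zero    (suc j) = lookup r j
adj {suc n} (r , g) (suc i) zero    = lookup r i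
adj {suc n} (r , g) (suc i) (suc j) = adj g i j

allFin : (n : ℕ) → List (Fin n)
allFin zero = []
allFin (suc n) = zero ∷ map suc (allFin n)

nbrs : ∀ {n} → Graph n → Fin n → List (Fin n)
nbrs G v = filter (λ w → T? (adj G v w)) (allFin _)

data Colour : Set where
  one : Colour
  col : Colour → List Colour → Colour

-- Equality of colours: the list component is a multiset, so lists are
-- compared up to permutation (recursively on colours).
data _≈ᶜ_ : Colour → Colour → Set where
  one≈ : one ≈ᶜ one
  col≈ : ∀ {a b l m} → a ≈ᶜ b → Permutation _≈ᶜ_ l m → col a l ≈ᶜ col b m

CR : ℕ → ∀ {n} → Graph n → Fin n → Colour
CR zero    G v = one
CR (suc i) G v = col (CR i G v) (map (CR i G) (nbrs G v))

_≅_ : ∀ {n} → Graph n → Graph n → Set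
_≅_ {n} G H = Data.Product.Σ (Permutation′ n)
  (λ π → ∀ i j → adj G i j ≡ adj H (π ⟨$⟩ʳ i) (π ⟨$⟩ʳ j))
  where import Data.Product

Property : ∀ {n} → Graph n → Set
Property {n} G = Data.Product.∃ λ (H : Graph n) →
  (G ≅ H → Data.Empty.⊥) × (∀ x → CR 2 G x ≈ᶜ CR 2 H x)
  where import Data.Product; import Data.Empty

-- Write m = n - 1. In G_{n,1/2} the quantity 2 deg(x) - m is a sum of m independent signs, whose
-- fourth moment is 3m² - 2m. By Markov's inequality and a union bound over the vertices, all but
-- O(n³/V⁴) of the graphs are balanced: every degree lies in a window of 2V + 2 values around m/2.
-- In a balanced graph C²(x) is determined by the number of neighbours of x of each degree in the
-- window, so the profile recording these numbers takes at most (n+1)^((2V+2)n) values, and graphs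
-- with equal profiles get equal colours. An isomorphism class has at most n^n labelled members, so
-- outside the at most (n+1)^((2V+2)n) n^n relabelings of one representative per profile, every
-- balanced graph has a non-isomorphic graph with the same profile. For V ≈ n / (8 log₂ n) both
-- exceptional sets are o(2^(n(n-1)/2)).

module Submission where

open import Defs

open import Level using (0ℓ)
open import Algebra.Core using (Op₂)
open import Algebra.Structures using (IsCommutativeSemiring)
open import Data.Bool using (Bool; true; false; T?)
open import Data.Fin using (Fin; zero; suc; toℕ; fromℕ<)
import Data.Fin.Properties as Fin
open import Data.Fin.Permutation using (_⟨$⟩ʳ_)
open import Data.List using (List; []; _∷_; _++_; map; concat; concatMap; filter; length; replicate; upTo)
import Data.List.Properties as List
open import Data.List.Membership.Propositional using (_∈_; _∉_; lose)
open import Data.List.Membership.Propositional.Properties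
  using (∈-map⁺; ∈-map⁻; ∈-concat⁺′; ∈-filter⁺; ∈-filter⁻; ∈-++⁺ˡ; ∈-++⁺ʳ; ∈-∃++; ∈-upTo⁺)
import Data.List.Relation.Unary.All as All
open import Data.List.Relation.Unary.Any using (Any; here; there; any?; satisfied)
open import Data.List.Relation.Binary.Pointwise using (Pointwise; []; _∷_)
import Data.List.Relation.Binary.Permutation.Homogeneous as Homogeneous
open import Data.List.Relation.Binary.Permutation.Propositional using (_↭_; ↭-refl; ↭-prep; ↭-sym; ↭-trans; ↭⇒↭ₛ)
import Data.List.Relation.Binary.Permutation.Propositional.Properties as ↭
open import Data.Nat using (ℕ; zero; suc; _+_; _*_; _∸_; _^_; _≤_; _<_; z≤n; s≤s; ∣_-_∣; ⌊_/2⌋; _≤?_; _<?_)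
import Data.Nat.Properties as ℕ
import Algebra.Properties.CommutativeSemigroup ℕ.*-commutativeSemigroup as ℕ*
open import Data.Nat.Combinatorics using (_C_; nC1≡n; nCk+nC[k+1]≡[n+1]C[k+1])
open import Data.Nat.DivMod using (_/_; _%_; m≡m%n+[m/n]*n; m%n<n; m/n*n≤m)
import Data.Nat.Tactic.RingSolver as ℕ-Ring
open import Data.Product using (_×_; _,_; proj₁; proj₂; ∃-syntax)
open import Data.Sum using (inj₁; inj₂)
open import Data.Unit using (tt)
open import Data.Vec using (Vec; []; _∷_; lookup; tabulate)
import Data.Vec.Properties as Vec
open import Data.Vec.Properties using (lookup∘tabulate; tabulate∘lookup; tabulate-cong)
open import Function using (_∘_)
open import Relation.Nullary using (¬_; ¬?; Dec; yes; no; does; contradiction; _×-dec_)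
open import Relation.Unary using (Pred; Decidable)
open import Relation.Binary.Definitions using (DecidableEquality)
open import Relation.Binary.PropositionalEquality

allVecs : {X : Set} → List X → (k : ℕ) → List (Vec X k)
allVecs xs zero    = [] ∷ []
allVecs xs (suc k) = concatMap (λ x → map (x ∷_) (allVecs xs k)) xs

bools : List Bool
bools = true ∷ false ∷ []

allGraphs : (n : ℕ) → List (Graph n)
allGraphs zero    = tt ∷ []
allGraphs (suc n) = concatMap (λ r → map (r ,_) (allGraphs n)) (allVecs bools n)

module ListSum {A : Set} {_+_ _*_ : Op₂ A} {0# 1# : A}
               (isCS : IsCommutativeSemiring _≡_ _+_ _*_ 0# 1#) where

  open IsCommutativeSemiring isCS
    using (+-assoc; +-comm; +-identityˡ; +-identityʳ; distribˡ; zeroʳ)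
  open ≡-Reasoning

  ∑ : {X : Set} → List X → (X → A) → A
  ∑ []       f = 0#
  ∑ (x ∷ xs) f = f x + ∑ xs f

  ∑-cong : {X : Set} (xs : List X) {f g : X → A} → (∀ x → f x ≡ g x) → ∑ xs f ≡ ∑ xs g
  ∑-cong []       f≗g = refl
  ∑-cong (x ∷ xs) f≗g = cong₂ _+_ (f≗g x) (∑-cong xs f≗g)

  ∑-++ : {X : Set} (xs ys : List X) (f : X → A) → ∑ (xs ++ ys) f ≡ ∑ xs f + ∑ ys f
  ∑-++ []       ys f = sym (+-identityˡ _)
  ∑-++ (x ∷ xs) ys f = trans (cong (f x +_) (∑-++ xs ys f)) (sym (+-assoc (f x) _ _))

  ∑-map : {X Y : Set} (g : X → Y) (xs : List X) (f : Y → A) → ∑ (map g xs) f ≡ ∑ xs (λ x → f (g x))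
  ∑-map g []       f = refl
  ∑-map g (x ∷ xs) f = cong (f (g x) +_) (∑-map g xs f)

  ∑-concat : {X : Set} (xss : List (List X)) (f : X → A) → ∑ (concat xss) f ≡ ∑ xss (λ xs → ∑ xs f)
  ∑-concat []         f = refl
  ∑-concat (xs ∷ xss) f = trans (∑-++ xs (concat xss) f) (cong (∑ xs f +_) (∑-concat xss f))

  ∑-product : {X Y Z : Set} (g : X → Y → Z) (xs : List X) (ys : List Y) (f : Z → A) →
              ∑ (concatMap (λ x → map (g x) ys) xs) f ≡ ∑ xs (λ x → ∑ ys (λ y → f (g x y)))
  ∑-product g xs ys f = begin
    ∑ (concat (map (λ x → map (g x) ys) xs)) f    ≡⟨ ∑-concat (map (λ x → map (g x) ys) xs) f ⟩
    ∑ (map (λ x → map (g x) ys) xs) (λ zs → ∑ zs f) ≡⟨ ∑-map (λ x → map (g x) ys) xs _ ⟩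
    ∑ xs (λ x → ∑ (map (g x) ys) f)               ≡⟨ ∑-cong xs (λ x → ∑-map (g x) ys f) ⟩
    ∑ xs (λ x → ∑ ys (λ y → f (g x y)))           ∎

  ∑-+ : {X : Set} (xs : List X) (f g : X → A) → ∑ xs (λ x → f x + g x) ≡ ∑ xs f + ∑ xs g
  ∑-+ []       f g = sym (+-identityˡ 0#)
  ∑-+ (x ∷ xs) f g = begin
    (f x + g x) + ∑ xs (λ x → f x + g x) ≡⟨ cong ((f x + g x) +_) (∑-+ xs f g) ⟩
    (f x + g x) + (∑ xs f + ∑ xs g)      ≡⟨ interchange (f x) (g x) (∑ xs f) (∑ xs g) ⟩
    (f x + ∑ xs f) + (g x + ∑ xs g)      ∎
    where
    interchange : ∀ a b c d → (a + b) + (c + d) ≡ (a + c) + (b + d)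
    interchange a b c d = begin
      (a + b) + (c + d) ≡⟨ +-assoc a b (c + d) ⟩
      a + (b + (c + d)) ≡⟨ cong (a +_) (sym (+-assoc b c d)) ⟩
      a + ((b + c) + d) ≡⟨ cong (λ z → a + (z + d)) (+-comm b c) ⟩
      a + ((c + b) + d) ≡⟨ cong (a +_) (+-assoc c b d) ⟩
      a + (c + (b + d)) ≡⟨ sym (+-assoc a c (b + d)) ⟩
      (a + c) + (b + d) ∎

  ∑-*ˡ : {X : Set} (c : A) (xs : List X) (f : X → A) → ∑ xs (λ x → c * f x) ≡ c * ∑ xs f
  ∑-*ˡ c []       f = sym (zeroʳ c)
  ∑-*ˡ c (x ∷ xs) f = trans (cong ((c * f x) +_) (∑-*ˡ c xs f)) (sym (distribˡ c (f x) (∑ xs f)))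

  ∑-zero : {X : Set} (xs : List X) → ∑ xs (λ _ → 0#) ≡ 0#
  ∑-zero []       = refl
  ∑-zero (x ∷ xs) = trans (+-identityˡ _) (∑-zero xs)

  ∑-comm : {X Y : Set} (xs : List X) (ys : List Y) (f : X → Y → A) →
           ∑ xs (λ x → ∑ ys (f x)) ≡ ∑ ys (λ y → ∑ xs (λ x → f x y))
  ∑-comm []       ys f = sym (∑-zero ys)
  ∑-comm (x ∷ xs) ys f = begin
    ∑ ys (f x) + ∑ xs (λ x → ∑ ys (f x))               ≡⟨ cong (∑ ys (f x) +_) (∑-comm xs ys f) ⟩
    ∑ ys (f x) + ∑ ys (λ y → ∑ xs (λ x → f x y))       ≡⟨ sym (∑-+ ys (f x) (λ y → ∑ xs (λ x → f x y))) ⟩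
    ∑ ys (λ y → f x y + ∑ xs (λ x → f x y))            ∎

  ∑-allVecs-suc : (m : ℕ) (f : Vec Bool (suc m) → A) →
                  ∑ (allVecs bools (suc m)) f ≡ ∑ (allVecs bools m) (λ r → f (true ∷ r)) + ∑ (allVecs bools m) (λ r → f (false ∷ r))
  ∑-allVecs-suc m f =
    trans (∑-product _∷_ bools (allVecs bools m) f) (cong (∑ (allVecs bools m) (λ r → f (true ∷ r)) +_) (+-identityʳ _))

module ℕ∑ = ListSum ℕ.+-*-isCommutativeSemiring
open ℕ∑ using (∑; ∑-cong; ∑-product; ∑-allVecs-suc; ∑-*ˡ; ∑-comm)

∑-const : {X : Set} (xs : List X) (c : ℕ) → ∑ xs (λ _ → c) ≡ length xs * c
∑-const []       c = refl
∑-const (x ∷ xs) c = cong (c +_) (∑-const xs c)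

∑-mono-≤ : {X : Set} (xs : List X) {f g : X → ℕ} → (∀ x → f x ≤ g x) → ∑ xs f ≤ ∑ xs g
∑-mono-≤ []       f≤g = z≤n
∑-mono-≤ (x ∷ xs) f≤g = ℕ.+-mono-≤ (f≤g x) (∑-mono-≤ xs f≤g)

∑-≤-const : {X : Set} (xs : List X) {f : X → ℕ} (c : ℕ) → (∀ x → f x ≤ c) → ∑ xs f ≤ length xs * c
∑-≤-const xs c f≤c = ℕ.≤-trans (∑-mono-≤ xs f≤c) (ℕ.≤-reflexive (∑-const xs c))

∈⇒≤∑ : {X : Set} (f : X → ℕ) {x : X} {xs : List X} → x ∈ xs → f x ≤ ∑ xs f
∈⇒≤∑ f (here refl) = ℕ.m≤m+n _ _
∈⇒≤∑ f {xs = y ∷ _} (there x∈) = ℕ.≤-trans (∈⇒≤∑ f x∈) (ℕ.m≤n+m _ (f y))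

length-concatMap : {X Y : Set} (g : X → List Y) (xs : List X) → length (concatMap g xs) ≡ ∑ xs (λ x → length (g x))
length-concatMap g []       = refl
length-concatMap g (x ∷ xs) = trans (List.length-++ (g x)) (cong (length (g x) +_) (length-concatMap g xs))

length-product : {X Y Z : Set} (g : X → Y → Z) (xs : List X) (ys : List Y) →
                 length (concatMap (λ x → map (g x) ys) xs) ≡ length xs * length ys
length-product g xs ys = begin
  length (concatMap (λ x → map (g x) ys) xs) ≡⟨ length-concatMap (λ x → map (g x) ys) xs ⟩
  ∑ xs (λ x → length (map (g x) ys))         ≡⟨ ∑-cong xs (λ x → List.length-map (g x) ys) ⟩
  ∑ xs (λ _ → length ys)                     ≡⟨ ∑-const xs (length ys) ⟩
  length xs * length ys                      ∎
  where open ≡-Reasoning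

∈-product : {X Y Z : Set} (g : X → Y → Z) {xs : List X} {ys : List Y} {x : X} {y : Y} →
            x ∈ xs → y ∈ ys → g x y ∈ concatMap (λ x → map (g x) ys) xs
∈-product g x∈ y∈ = ∈-concat⁺′ (∈-map⁺ (g _) y∈) (∈-map⁺ (λ x → map (g x) _) x∈)

length-allVecs : {X : Set} (xs : List X) (k : ℕ) → length (allVecs xs k) ≡ length xs ^ k
length-allVecs xs zero    = refl
length-allVecs xs (suc k) =
  trans (length-product _∷_ xs (allVecs xs k)) (cong (length xs *_) (length-allVecs xs k))

∈-allVecs : {X : Set} (xs : List X) {k : ℕ} (v : Vec X k) → (∀ i → lookup v i ∈ xs) → v ∈ allVecs xs k
∈-allVecs xs []      _   = here refl
∈-allVecs xs (x ∷ v) v∈ = ∈-product _∷_ (v∈ zero) (∈-allVecs xs v (λ i → v∈ (suc i)))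

∈-allFin : (n : ℕ) (i : Fin n) → i ∈ allFin n
∈-allFin (suc n) zero    = here refl
∈-allFin (suc n) (suc i) = there (∈-map⁺ suc (∈-allFin n i))

length-allFin : (n : ℕ) → length (allFin n) ≡ n
length-allFin zero    = refl
length-allFin (suc n) = cong suc (trans (List.length-map suc (allFin n)) (length-allFin n))

∈-bools : (b : Bool) → b ∈ bools
∈-bools true  = here refl
∈-bools false = there (here refl)

∈-allGraphs : {n : ℕ} (G : Graph n) → G ∈ allGraphs n
∈-allGraphs {zero}  tt      = here refl
∈-allGraphs {suc n} (r , g) = ∈-product _,_ (∈-allVecs bools r (λ i → ∈-bools _)) (∈-allGraphs g)

suc-C-2 : (n : ℕ) → suc n C 2 ≡ n + n C 2
suc-C-2 n = trans (sym (nCk+nC[k+1]≡[n+1]C[k+1] n 1)) (cong (_+ n C 2) (nC1≡n n))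

2^suc-C-2 : (n : ℕ) → 2 ^ (suc n C 2) ≡ 2 ^ n * 2 ^ (n C 2)
2^suc-C-2 n = trans (cong (2 ^_) (suc-C-2 n)) (ℕ.^-distribˡ-+-* 2 n (n C 2))

length-allGraphs : (n : ℕ) → length (allGraphs n) ≡ 2 ^ (n C 2)
length-allGraphs zero    = refl
length-allGraphs (suc n) = begin
  length (allGraphs (suc n))                        ≡⟨ length-product _,_ (allVecs bools n) (allGraphs n) ⟩
  length (allVecs bools n) * length (allGraphs n)   ≡⟨ cong₂ _*_ (length-allVecs bools n) (length-allGraphs n) ⟩
  2 ^ n * 2 ^ (n C 2)                               ≡⟨ sym (2^suc-C-2 n) ⟩
  2 ^ (suc n C 2)                                   ∎
  where open ≡-Reasoning

-- The degree distribution

deg : {n : ℕ} → Graph n → Fin n → ℕ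
deg G x = length (nbrs G x)

bit : Bool → ℕ
bit true  = 1
bit false = 0

trues : {m : ℕ} → Vec Bool m → ℕ
trues []      = 0
trues (b ∷ r) = bit b + trues r

length-filter-map : {X Y : Set} {P : Pred Y 0ℓ} (P? : Decidable P) (f : X → Y) (xs : List X) →
                    length (filter P? (map f xs)) ≡ length (filter (λ x → P? (f x)) xs)
length-filter-map P? f []       = refl
length-filter-map P? f (x ∷ xs) with does (P? (f x))
... | true  = cong suc (length-filter-map P? f xs)
... | false = length-filter-map P? f xs

trues-filter : {m : ℕ} (r : Vec Bool m) → length (filter (λ j → T? (lookup r j)) (allFin m)) ≡ trues r
trues-filter []          = refl
trues-filter (true ∷ r)  = cong suc (trans (length-filter-map (λ j → T? (lookup (true ∷ r) j)) suc (allFin _)) (trues-filter r))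
trues-filter (false ∷ r) = trans (length-filter-map (λ j → T? (lookup (false ∷ r) j)) suc (allFin _)) (trues-filter r)

deg-zero : {m : ℕ} (r : Vec Bool m) (g : Graph m) → deg {suc m} (r , g) zero ≡ trues r
deg-zero r g = trans (length-filter-map (λ w → T? (adj (r , g) zero w)) suc (allFin _)) (trues-filter r)

deg-suc : {m : ℕ} (r : Vec Bool m) (g : Graph m) (i : Fin m) → deg {suc m} (r , g) (suc i) ≡ bit (lookup r i) + deg g i
deg-suc r g i with lookup r i
... | true  = cong suc (length-filter-map (λ w → T? (adj (r , g) (suc i) w)) suc (allFin _))
... | false = length-filter-map (λ w → T? (adj (r , g) (suc i) w)) suc (allFin _)

∑-lookup : (m : ℕ) (i : Fin (suc m)) (h : Bool → ℕ) →
           ∑ (allVecs bools (suc m)) (λ r → h (lookup r i)) ≡ 2 ^ m * (h true + h false)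
∑-lookup m zero h = begin
  ∑ (allVecs bools (suc m)) (λ r → h (lookup r zero))
    ≡⟨ ∑-allVecs-suc m (λ r → h (lookup r zero)) ⟩
  ∑ (allVecs bools m) (λ _ → h true) + ∑ (allVecs bools m) (λ _ → h false)
    ≡⟨ cong₂ _+_ (∑-const (allVecs bools m) (h true)) (∑-const (allVecs bools m) (h false)) ⟩
  length (allVecs bools m) * h true + length (allVecs bools m) * h false
    ≡⟨ sym (ℕ.*-distribˡ-+ (length (allVecs bools m)) (h true) (h false)) ⟩
  length (allVecs bools m) * (h true + h false)
    ≡⟨ cong (_* (h true + h false)) (length-allVecs bools m) ⟩
  2 ^ m * (h true + h false) ∎
  where open ≡-Reasoning
∑-lookup (suc m) (suc i) h = begin
  ∑ (allVecs bools (suc (suc m))) (λ r → h (lookup r (suc i)))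
    ≡⟨ ∑-allVecs-suc (suc m) (λ r → h (lookup r (suc i))) ⟩
  ∑ (allVecs bools (suc m)) (λ r → h (lookup r i)) + ∑ (allVecs bools (suc m)) (λ r → h (lookup r i))
    ≡⟨ cong₂ _+_ (∑-lookup m i h) (∑-lookup m i h) ⟩
  2 ^ m * (h true + h false) + 2 ^ m * (h true + h false)
    ≡⟨ cong (2 ^ m * (h true + h false) +_) (sym (ℕ.+-identityʳ _)) ⟩
  2 * (2 ^ m * (h true + h false))
    ≡⟨ sym (ℕ.*-assoc 2 (2 ^ m) _) ⟩
  2 ^ suc m * (h true + h false) ∎
  where open ≡-Reasoning

∑-deg≡∑-trues : (m : ℕ) (x : Fin (suc m)) (F : ℕ → ℕ) →
        ∑ (allGraphs (suc m)) (λ G → F (deg G x)) ≡ 2 ^ (m C 2) * ∑ (allVecs bools m) (λ r → F (trues r))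
∑-deg≡∑-trues m zero F = begin
  ∑ (allGraphs (suc m)) (λ G → F (deg G zero))
    ≡⟨ ∑-product _,_ rs (allGraphs m) (λ G → F (deg G zero)) ⟩
  ∑ rs (λ r → ∑ (allGraphs m) (λ g → F (deg (r , g) zero)))
    ≡⟨ ∑-cong rs (λ r → ∑-cong (allGraphs m) (λ g → cong F (deg-zero r g))) ⟩
  ∑ rs (λ r → ∑ (allGraphs m) (λ _ → F (trues r)))
    ≡⟨ ∑-cong rs (λ r → trans (∑-const (allGraphs m) _) (cong (_* F (trues r)) (length-allGraphs m))) ⟩
  ∑ rs (λ r → 2 ^ (m C 2) * F (trues r))
    ≡⟨ ∑-*ˡ (2 ^ (m C 2)) rs (λ r → F (trues r)) ⟩
  2 ^ (m C 2) * ∑ rs (λ r → F (trues r)) ∎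
  where
  open ≡-Reasoning
  rs = allVecs bools m
∑-deg≡∑-trues (suc m) (suc i) F = begin
  ∑ (allGraphs (suc (suc m))) (λ G → F (deg G (suc i)))
    ≡⟨ ∑-product _,_ (allVecs bools (suc m)) (allGraphs (suc m)) (λ G → F (deg G (suc i))) ⟩
  ∑ (allVecs bools (suc m)) (λ r → ∑ (allGraphs (suc m)) (λ g → F (deg (r , g) (suc i))))
    ≡⟨ ∑-cong (allVecs bools (suc m)) (λ r → ∑-cong (allGraphs (suc m)) (λ g → cong F (deg-suc r g i))) ⟩
  ∑ (allVecs bools (suc m)) (λ r → h (lookup r i))
    ≡⟨ ∑-lookup m i h ⟩
  2 ^ m * (h true + h false)
    ≡⟨ cong (2 ^ m *_) (cong₂ _+_ (∑-deg≡∑-trues m i (λ d → F (suc d))) (∑-deg≡∑-trues m i F)) ⟩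
  2 ^ m * (2 ^ (m C 2) * ∑ rs (λ r → F (suc (trues r))) + 2 ^ (m C 2) * ∑ rs (λ r → F (trues r)))
    ≡⟨ cong (2 ^ m *_) (sym (ℕ.*-distribˡ-+ (2 ^ (m C 2)) _ _)) ⟩
  2 ^ m * (2 ^ (m C 2) * (∑ rs (λ r → F (suc (trues r))) + ∑ rs (λ r → F (trues r))))
    ≡⟨ sym (ℕ.*-assoc (2 ^ m) (2 ^ (m C 2)) _) ⟩
  2 ^ m * 2 ^ (m C 2) * (∑ rs (λ r → F (suc (trues r))) + ∑ rs (λ r → F (trues r)))
    ≡⟨ cong₂ _*_ (sym (2^suc-C-2 m)) (sym (∑-allVecs-suc m (λ r → F (trues r)))) ⟩
  2 ^ (suc m C 2) * ∑ (allVecs bools (suc m)) (λ r → F (trues r)) ∎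
  where
  open ≡-Reasoning
  rs = allVecs bools m
  h : Bool → ℕ
  h b = ∑ (allGraphs (suc m)) (λ g → F (bit b + deg g i))

-- Integers are opened only inside this module: their prefix +_ would make sections such as (a +_) of
-- ℕ's _+_ ambiguous elsewhere.
module FourthMoment where

  open import Data.Integer using (ℤ; +_; -[1+_]; 0ℤ; 1ℤ; -1ℤ; ∣_∣; _⊖_)
  import Data.Integer as ℤ
  import Data.Integer.Properties as ℤₚ
  import Data.Integer.Tactic.RingSolver as ℤ-Ring

  module ℤ∑ = ListSum ℤₚ.+-*-isCommutativeSemiring

  pos-∑ : {X : Set} (xs : List X) (f : X → ℕ) → + ∑ xs f ≡ ℤ∑.∑ xs (λ x → + f x)
  pos-∑ []       f = refl
  pos-∑ (x ∷ xs) f = trans (ℤₚ.pos-+ (f x) (∑ xs f)) (cong (λ z → + f x ℤ.+ z) (pos-∑ xs f))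

  sign : Bool → ℤ
  sign true  = 1ℤ
  sign false = -1ℤ

  signSum : {m : ℕ} → Vec Bool m → ℤ
  signSum []      = 0ℤ
  signSum (b ∷ r) = sign b ℤ.+ signSum r

  2*trues≡signSum+m : {m : ℕ} (r : Vec Bool m) → + (2 * trues r) ≡ signSum r ℤ.+ + m
  2*trues≡signSum+m []              = refl
  2*trues≡signSum+m {suc m} (b ∷ r) = begin
    + (2 * (bit b + trues r))             ≡⟨ cong +_ (ℕ.*-distribˡ-+ 2 (bit b) (trues r)) ⟩
    + (2 * bit b + 2 * trues r)           ≡⟨ ℤₚ.pos-+ (2 * bit b) (2 * trues r) ⟩
    + (2 * bit b) ℤ.+ + (2 * trues r)     ≡⟨ cong (λ z → + (2 * bit b) ℤ.+ z) (2*trues≡signSum+m r) ⟩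
    + (2 * bit b) ℤ.+ (signSum r ℤ.+ + m) ≡⟨ regroup b (signSum r) (+ m) ⟩
    (sign b ℤ.+ signSum r) ℤ.+ + suc m    ∎
    where
    open ≡-Reasoning
    regroup : ∀ b s t → + (2 * bit b) ℤ.+ (s ℤ.+ t) ≡ (sign b ℤ.+ s) ℤ.+ (1ℤ ℤ.+ t)
    regroup true  = ℤ-Ring.solve-∀
    regroup false = ℤ-Ring.solve-∀

  square fourth : ℤ → ℤ
  square s = s ℤ.* s
  fourth s = square s ℤ.* square s

  ∑-signSum-suc : (m : ℕ) (F : ℤ → ℤ) →
    ℤ∑.∑ (allVecs bools (suc m)) (λ r → F (signSum r)) ≡ ℤ∑.∑ (allVecs bools m) (λ r → F (1ℤ ℤ.+ signSum r) ℤ.+ F (-1ℤ ℤ.+ signSum r))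
  ∑-signSum-suc m F = trans (ℤ∑.∑-allVecs-suc m (λ r → F (signSum r)))
                            (sym (ℤ∑.∑-+ (allVecs bools m) (λ r → F (1ℤ ℤ.+ signSum r)) (λ r → F (-1ℤ ℤ.+ signSum r))))

  ∑-const-ℤ : {X : Set} (xs : List X) (c : ℕ) → ℤ∑.∑ xs (λ _ → + c) ≡ + (length xs * c)
  ∑-const-ℤ xs c = trans (sym (pos-∑ xs (λ _ → c))) (cong +_ (∑-const xs c))

  ∑-square-signSum : (m : ℕ) → ℤ∑.∑ (allVecs bools m) (λ r → square (signSum r)) ≡ + m ℤ.* + (2 ^ m)
  ∑-square-signSum zero    = refl
  ∑-square-signSum (suc m) = begin
    ℤ∑.∑ (allVecs bools (suc m)) (λ r → square (signSum r))
      ≡⟨ ∑-signSum-suc m square ⟩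
    ℤ∑.∑ rs (λ r → square (1ℤ ℤ.+ signSum r) ℤ.+ square (-1ℤ ℤ.+ signSum r))
      ≡⟨ ℤ∑.∑-cong rs (λ r → binomial (signSum r)) ⟩
    ℤ∑.∑ rs (λ r → + 2 ℤ.* square (signSum r) ℤ.+ + 2)
      ≡⟨ ℤ∑.∑-+ rs (λ r → + 2 ℤ.* square (signSum r)) (λ _ → + 2) ⟩
    ℤ∑.∑ rs (λ r → + 2 ℤ.* square (signSum r)) ℤ.+ ℤ∑.∑ rs (λ _ → + 2)
      ≡⟨ cong₂ ℤ._+_ (ℤ∑.∑-*ˡ (+ 2) rs (λ r → square (signSum r))) (∑-const-ℤ rs 2) ⟩
    + 2 ℤ.* ℤ∑.∑ rs (λ r → square (signSum r)) ℤ.+ + (length rs * 2)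
      ≡⟨ cong₂ (λ a b → + 2 ℤ.* a ℤ.+ + (b * 2)) (∑-square-signSum m) (length-allVecs bools m) ⟩
    + 2 ℤ.* (+ m ℤ.* + (2 ^ m)) ℤ.+ + (2 ^ m * 2)
      ≡⟨ cong (λ z → + 2 ℤ.* (+ m ℤ.* + (2 ^ m)) ℤ.+ z) (ℤₚ.pos-* (2 ^ m) 2) ⟩
    + 2 ℤ.* (+ m ℤ.* + (2 ^ m)) ℤ.+ + (2 ^ m) ℤ.* + 2
      ≡⟨ regroup (+ m) (+ (2 ^ m)) ⟩
    (1ℤ ℤ.+ + m) ℤ.* (+ 2 ℤ.* + (2 ^ m))
      ≡⟨ cong ((1ℤ ℤ.+ + m) ℤ.*_) (sym (ℤₚ.pos-* 2 (2 ^ m))) ⟩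
    + suc m ℤ.* + (2 ^ suc m) ∎
    where
    open ≡-Reasoning
    rs = allVecs bools m
    binomial : ∀ s → (1ℤ ℤ.+ s) ℤ.* (1ℤ ℤ.+ s) ℤ.+ (-1ℤ ℤ.+ s) ℤ.* (-1ℤ ℤ.+ s) ≡ + 2 ℤ.* (s ℤ.* s) ℤ.+ + 2
    binomial = ℤ-Ring.solve-∀
    regroup : ∀ a p → + 2 ℤ.* (a ℤ.* p) ℤ.+ p ℤ.* + 2 ≡ (1ℤ ℤ.+ a) ℤ.* (+ 2 ℤ.* p)
    regroup = ℤ-Ring.solve-∀

  ∑-fourth-signSum : (m : ℕ) →
    ℤ∑.∑ (allVecs bools m) (λ r → fourth (signSum r)) ≡ (+ 3 ℤ.* + m ℤ.* + m ℤ.- + 2 ℤ.* + m) ℤ.* + (2 ^ m)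
  ∑-fourth-signSum zero    = refl
  ∑-fourth-signSum (suc m) = begin
    ℤ∑.∑ (allVecs bools (suc m)) (λ r → fourth (signSum r))
      ≡⟨ ∑-signSum-suc m fourth ⟩
    ℤ∑.∑ rs (λ r → fourth (1ℤ ℤ.+ signSum r) ℤ.+ fourth (-1ℤ ℤ.+ signSum r))
      ≡⟨ ℤ∑.∑-cong rs (λ r → binomial (signSum r)) ⟩
    ℤ∑.∑ rs (λ r → (+ 2 ℤ.* fourth (signSum r) ℤ.+ + 12 ℤ.* square (signSum r)) ℤ.+ + 2)
      ≡⟨ ℤ∑.∑-+ rs _ (λ _ → + 2) ⟩
    ℤ∑.∑ rs (λ r → + 2 ℤ.* fourth (signSum r) ℤ.+ + 12 ℤ.* square (signSum r)) ℤ.+ ℤ∑.∑ rs (λ _ → + 2)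
      ≡⟨ cong₂ ℤ._+_ (ℤ∑.∑-+ rs (λ r → + 2 ℤ.* fourth (signSum r)) (λ r → + 12 ℤ.* square (signSum r))) (∑-const-ℤ rs 2) ⟩
    ℤ∑.∑ rs (λ r → + 2 ℤ.* fourth (signSum r)) ℤ.+ ℤ∑.∑ rs (λ r → + 12 ℤ.* square (signSum r)) ℤ.+ + (length rs * 2)
      ≡⟨ cong₂ (λ a b → a ℤ.+ b ℤ.+ + (length rs * 2))
               (ℤ∑.∑-*ˡ (+ 2) rs (λ r → fourth (signSum r))) (ℤ∑.∑-*ˡ (+ 12) rs (λ r → square (signSum r))) ⟩
    + 2 ℤ.* ℤ∑.∑ rs (λ r → fourth (signSum r)) ℤ.+ + 12 ℤ.* ℤ∑.∑ rs (λ r → square (signSum r)) ℤ.+ + (length rs * 2)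
      ≡⟨ cong₂ (λ a b → + 2 ℤ.* a ℤ.+ + 12 ℤ.* b ℤ.+ + (length rs * 2)) (∑-fourth-signSum m) (∑-square-signSum m) ⟩
    + 2 ℤ.* (c ℤ.* p) ℤ.+ + 12 ℤ.* (+ m ℤ.* p) ℤ.+ + (length rs * 2)
      ≡⟨ cong (λ z → + 2 ℤ.* (c ℤ.* p) ℤ.+ + 12 ℤ.* (+ m ℤ.* p) ℤ.+ z)
              (trans (cong (λ l → + (l * 2)) (length-allVecs bools m)) (ℤₚ.pos-* (2 ^ m) 2)) ⟩
    + 2 ℤ.* (c ℤ.* p) ℤ.+ + 12 ℤ.* (+ m ℤ.* p) ℤ.+ p ℤ.* + 2
      ≡⟨ regroup (+ m) p ⟩
    (+ 3 ℤ.* (1ℤ ℤ.+ + m) ℤ.* (1ℤ ℤ.+ + m) ℤ.- + 2 ℤ.* (1ℤ ℤ.+ + m)) ℤ.* (+ 2 ℤ.* p)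
      ≡⟨ cong (λ z → (+ 3 ℤ.* + suc m ℤ.* + suc m ℤ.- + 2 ℤ.* + suc m) ℤ.* z) (sym (ℤₚ.pos-* 2 (2 ^ m))) ⟩
    (+ 3 ℤ.* + suc m ℤ.* + suc m ℤ.- + 2 ℤ.* + suc m) ℤ.* + (2 ^ suc m) ∎
    where
    open ≡-Reasoning
    rs = allVecs bools m
    c = + 3 ℤ.* + m ℤ.* + m ℤ.- + 2 ℤ.* + m
    p = + (2 ^ m)
    binomial : ∀ s → (1ℤ ℤ.+ s) ℤ.* (1ℤ ℤ.+ s) ℤ.* ((1ℤ ℤ.+ s) ℤ.* (1ℤ ℤ.+ s))
                       ℤ.+ (-1ℤ ℤ.+ s) ℤ.* (-1ℤ ℤ.+ s) ℤ.* ((-1ℤ ℤ.+ s) ℤ.* (-1ℤ ℤ.+ s))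
                     ≡ (+ 2 ℤ.* (s ℤ.* s ℤ.* (s ℤ.* s)) ℤ.+ + 12 ℤ.* (s ℤ.* s)) ℤ.+ + 2
    binomial = ℤ-Ring.solve-∀
    regroup : ∀ a p → + 2 ℤ.* ((+ 3 ℤ.* a ℤ.* a ℤ.- + 2 ℤ.* a) ℤ.* p) ℤ.+ + 12 ℤ.* (a ℤ.* p) ℤ.+ p ℤ.* + 2
                    ≡ (+ 3 ℤ.* (1ℤ ℤ.+ a) ℤ.* (1ℤ ℤ.+ a) ℤ.- + 2 ℤ.* (1ℤ ℤ.+ a)) ℤ.* (+ 2 ℤ.* p)
    regroup = ℤ-Ring.solve-∀

  ∣⊖∣≡∣-∣ : (a b : ℕ) → ∣ a ⊖ b ∣ ≡ ∣ a - b ∣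
  ∣⊖∣≡∣-∣ a b with ℕ.≤-total a b
  ... | inj₁ a≤b = trans (ℤₚ.∣⊖∣-≤ a≤b) (sym (ℕ.m≤n⇒∣m-n∣≡n∸m a≤b))
  ... | inj₂ b≤a = trans (ℤₚ.∣m⊖n∣≡∣n⊖m∣ a b) (trans (ℤₚ.∣⊖∣-≤ b≤a) (sym (ℕ.m≤n⇒∣n-m∣≡n∸m b≤a)))

  ∣∣≡∣-∣ : {s : ℤ} {a b : ℕ} → + a ≡ s ℤ.+ + b → ∣ s ∣ ≡ ∣ a - b ∣
  ∣∣≡∣-∣ {s} {a} {b} a≡s+b = begin
    ∣ s ∣                        ≡⟨ cong ∣_∣ (cancel s (+ b)) ⟩
    ∣ (s ℤ.+ + b) ℤ.- + b ∣      ≡⟨ cong (λ z → ∣ z ℤ.- + b ∣) (sym a≡s+b) ⟩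
    ∣ + a ℤ.- + b ∣              ≡⟨ cong ∣_∣ (ℤₚ.m-n≡m⊖n a b) ⟩
    ∣ a ⊖ b ∣                    ≡⟨ ∣⊖∣≡∣-∣ a b ⟩
    ∣ a - b ∣                    ∎
    where
    open ≡-Reasoning
    cancel : ∀ s t → s ≡ (s ℤ.+ t) ℤ.- t
    cancel = ℤ-Ring.solve-∀

  pos-^ : (a n : ℕ) → + (a ^ n) ≡ (+ a) ℤ.^ n
  pos-^ a zero    = refl
  pos-^ a (suc n) = trans (ℤₚ.pos-* a (a ^ n)) (cong (+ a ℤ.*_) (pos-^ a n))

  pos-∣∣^4 : (s : ℤ) → + (∣ s ∣ ^ 4) ≡ fourth s
  pos-∣∣^4 (+ a)      = trans (pos-^ a 4) (expand (+ a))
    where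
    expand : ∀ t → t ℤ.* (t ℤ.* (t ℤ.* (t ℤ.* 1ℤ))) ≡ t ℤ.* t ℤ.* (t ℤ.* t)
    expand = ℤ-Ring.solve-∀
  pos-∣∣^4 -[1+ a ] = trans (pos-^ (suc a) 4) (expand-neg (+ suc a))
    where
    expand-neg : ∀ t → t ℤ.* (t ℤ.* (t ℤ.* (t ℤ.* 1ℤ))) ≡ (ℤ.- t) ℤ.* (ℤ.- t) ℤ.* ((ℤ.- t) ℤ.* (ℤ.- t))
    expand-neg = ℤ-Ring.solve-∀

  ∑-trues-fourth-moment : (m : ℕ) → ∑ (allVecs bools m) (λ r → ∣ 2 * trues r - m ∣ ^ 4) ≤ 3 * m * m * 2 ^ m
  ∑-trues-fourth-moment m = ℕ.≤-trans (ℕ.m≤m+n S (2 * m * 2 ^ m)) (ℕ.≤-reflexive (ℤₚ.+-injective sums))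
    where
    open ≡-Reasoning
    rs = allVecs bools m
    S = ∑ rs (λ r → ∣ 2 * trues r - m ∣ ^ 4)
    term : ∀ r → + (∣ 2 * trues r - m ∣ ^ 4) ≡ fourth (signSum r)
    term r = trans (cong (λ z → + (z ^ 4)) (sym (∣∣≡∣-∣ {signSum r} (2*trues≡signSum+m r)))) (pos-∣∣^4 (signSum r))
    sums : + (S + 2 * m * 2 ^ m) ≡ + (3 * m * m * 2 ^ m)
    sums = begin
      + (S + 2 * m * 2 ^ m)
        ≡⟨ ℤₚ.pos-+ S (2 * m * 2 ^ m) ⟩
      + S ℤ.+ + (2 * m * 2 ^ m)
        ≡⟨ cong₂ ℤ._+_ (trans (pos-∑ rs _) (ℤ∑.∑-cong rs term)) (pos-*³ 2 m (2 ^ m)) ⟩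
      ℤ∑.∑ rs (λ r → fourth (signSum r)) ℤ.+ + 2 ℤ.* + m ℤ.* + (2 ^ m)
        ≡⟨ cong (ℤ._+ + 2 ℤ.* + m ℤ.* + (2 ^ m)) (∑-fourth-signSum m) ⟩
      (+ 3 ℤ.* + m ℤ.* + m ℤ.- + 2 ℤ.* + m) ℤ.* + (2 ^ m) ℤ.+ + 2 ℤ.* + m ℤ.* + (2 ^ m)
        ≡⟨ cancel (+ m) (+ (2 ^ m)) ⟩
      + 3 ℤ.* + m ℤ.* + m ℤ.* + (2 ^ m)
        ≡⟨ sym (trans (ℤₚ.pos-* (3 * m * m) (2 ^ m)) (cong (ℤ._* + (2 ^ m)) (pos-*³ 3 m m))) ⟩
      + (3 * m * m * 2 ^ m) ∎
      where
      pos-*³ : ∀ a b c → + (a * b * c) ≡ + a ℤ.* + b ℤ.* + c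
      pos-*³ a b c = trans (ℤₚ.pos-* (a * b) c) (cong (ℤ._* + c) (ℤₚ.pos-* a b))
      cancel : ∀ a p → (+ 3 ℤ.* a ℤ.* a ℤ.- + 2 ℤ.* a) ℤ.* p ℤ.+ + 2 ℤ.* a ℤ.* p ≡ + 3 ℤ.* a ℤ.* a ℤ.* p
      cancel = ℤ-Ring.solve-∀

open FourthMoment using (∑-trues-fourth-moment)

-- Balanced graphs

markov : {X : Set} {P : Pred X 0ℓ} (P? : Decidable P) (f : X → ℕ) (c : ℕ) →
         (∀ x → P x → c ≤ f x) → (xs : List X) → length (filter P? xs) * c ≤ ∑ xs f
markov P? f c c≤f []       = z≤n
markov P? f c c≤f (x ∷ xs) with P? x
... | yes px = ℕ.+-mono-≤ (c≤f x px) (markov P? f c c≤f xs)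
... | no  _  = ℕ.≤-trans (markov P? f c c≤f xs) (ℕ.m≤n+m _ (f x))

windowStart : ℕ → ℕ → ℕ
windowStart m V = ⌊ m /2⌋ ∸ V

windowWidth : ℕ → ℕ
windowWidth V = 2 * V + 2

InWindow : ℕ → ℕ → ℕ → Set
InWindow m V d = windowStart m V ≤ d × d < windowStart m V + windowWidth V

inWindow? : (m V d : ℕ) → Dec (InWindow m V d)
inWindow? m V d = windowStart m V ≤? d ×-dec d <? windowStart m V + windowWidth V

2*⌊n/2⌋≤n : (n : ℕ) → 2 * ⌊ n /2⌋ ≤ n
2*⌊n/2⌋≤n zero          = z≤n
2*⌊n/2⌋≤n (suc zero)    = z≤n
2*⌊n/2⌋≤n (suc (suc n)) = subst (_≤ suc (suc n)) (sym (ℕ.*-suc 2 ⌊ n /2⌋)) (s≤s (s≤s (2*⌊n/2⌋≤n n)))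

n≤1+2*⌊n/2⌋ : (n : ℕ) → n ≤ suc (2 * ⌊ n /2⌋)
n≤1+2*⌊n/2⌋ zero          = z≤n
n≤1+2*⌊n/2⌋ (suc zero)    = s≤s z≤n
n≤1+2*⌊n/2⌋ (suc (suc n)) = subst (suc (suc n) ≤_) (cong suc (sym (ℕ.*-suc 2 ⌊ n /2⌋))) (s≤s (s≤s (n≤1+2*⌊n/2⌋ n)))

+-≤⇒≤∸ : (a b : ℕ) {c : ℕ} → a + b ≤ c → b ≤ c ∸ a
+-≤⇒≤∸ a b a+b≤c = subst (_≤ _ ∸ a) (ℕ.m+n∸m≡n a b) (ℕ.∸-monoˡ-≤ a a+b≤c)

outside-window-far : (m V d : ℕ) → ¬ InWindow m V d → 2 * V ≤ ∣ 2 * d - m ∣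
outside-window-far m V d out with windowStart m V ≤? d
... | no d<lo = ℕ.≤-trans (+-≤⇒≤∸ (2 * d) (2 * V) 2d+2V≤m) (subst (m ∸ 2 * d ≤_) (ℕ.∣-∣-comm m (2 * d)) (ℕ.m∸n≤∣m-n∣ m (2 * d)))
  where
  open ℕ.≤-Reasoning
  V<half : V < ⌊ m /2⌋
  V<half = ℕ.m∸n≢0⇒n<m (λ lo≡0 → contradiction (subst (d <_) lo≡0 (ℕ.≰⇒> d<lo)) λ ())
  2d+2V≤m : 2 * d + 2 * V ≤ m
  2d+2V≤m = begin
    2 * d + 2 * V ≡⟨ sym (ℕ.*-distribˡ-+ 2 d V) ⟩
    2 * (d + V)   ≤⟨ ℕ.*-monoʳ-≤ 2 (ℕ.≤-trans (ℕ.n≤1+n (d + V)) (ℕ.m≤o∸n⇒m+n≤o (suc d) (ℕ.<⇒≤ V<half) (ℕ.≰⇒> d<lo))) ⟩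
    2 * ⌊ m /2⌋   ≤⟨ 2*⌊n/2⌋≤n m ⟩
    m             ∎
... | yes lo≤d = ℕ.≤-trans (+-≤⇒≤∸ m (2 * V) m+2V≤2d) (ℕ.m∸n≤∣m-n∣ (2 * d) m)
  where
  open ℕ.≤-Reasoning
  lo = windowStart m V
  m+2V≤2d : m + 2 * V ≤ 2 * d
  m+2V≤2d = begin
    m + 2 * V                               ≤⟨ ℕ.+-monoˡ-≤ (2 * V) (n≤1+2*⌊n/2⌋ m) ⟩
    suc (2 * ⌊ m /2⌋) + 2 * V               ≤⟨ ℕ.+-monoˡ-≤ (2 * V) (s≤s (ℕ.*-monoʳ-≤ 2 (ℕ.m≤n+m∸n ⌊ m /2⌋ V))) ⟩
    suc (2 * (V + lo)) + 2 * V           <⟨ ℕ.≤-trans (ℕ.m≤m+n _ 2) (ℕ.≤-reflexive (regroup V lo)) ⟩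
    2 * (lo + windowWidth V)             ≤⟨ ℕ.*-monoʳ-≤ 2 (ℕ.≮⇒≥ (λ d<end → out (lo≤d , d<end))) ⟩
    2 * d                                   ∎
    where
    regroup : ∀ V s → suc (suc (2 * (V + s)) + 2 * V) + 2 ≡ 2 * (s + (2 * V + 2))
    regroup = ℕ-Ring.solve-∀

∑-deg-fourth-moment : (m : ℕ) (x : Fin (suc m)) →
                      ∑ (allGraphs (suc m)) (λ G → ∣ 2 * deg G x - m ∣ ^ 4) ≤ 3 * m * m * 2 ^ (suc m C 2)
∑-deg-fourth-moment m x = begin
  ∑ (allGraphs (suc m)) (λ G → ∣ 2 * deg G x - m ∣ ^ 4)
    ≡⟨ ∑-deg≡∑-trues m x (λ d → ∣ 2 * d - m ∣ ^ 4) ⟩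
  2 ^ (m C 2) * ∑ (allVecs bools m) (λ r → ∣ 2 * trues r - m ∣ ^ 4)
    ≤⟨ ℕ.*-monoʳ-≤ (2 ^ (m C 2)) (∑-trues-fourth-moment m) ⟩
  2 ^ (m C 2) * (3 * m * m * 2 ^ m)
    ≡⟨ regroup (2 ^ (m C 2)) (3 * m * m) (2 ^ m) ⟩
  3 * m * m * (2 ^ m * 2 ^ (m C 2))
    ≡⟨ cong (3 * m * m *_) (sym (2^suc-C-2 m)) ⟩
  3 * m * m * 2 ^ (suc m C 2) ∎
  where
  open ℕ.≤-Reasoning
  regroup : ∀ a b c → a * (b * c) ≡ b * (c * a)
  regroup = ℕ-Ring.solve-∀

Balanced : (m V : ℕ) → Graph (suc m) → Set
Balanced m V G = ∀ x → InWindow m V (deg G x)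

balanced? : (m V : ℕ) (G : Graph (suc m)) → Dec (Balanced m V G)
balanced? m V G = Fin.all? (λ x → inWindow? m V (deg G x))

unbalanced : (m V : ℕ) → List (Graph (suc m))
unbalanced m V = filter (λ G → ¬? (balanced? m V G)) (allGraphs (suc m))

length-unbalanced : (m V : ℕ) → length (unbalanced m V) * (2 * V) ^ 4 ≤ suc m * (3 * m * m * 2 ^ (suc m C 2))
length-unbalanced m V = begin
  length (unbalanced m V) * (2 * V) ^ 4
    ≤⟨ markov (λ G → ¬? (balanced? m V G)) total ((2 * V) ^ 4) far (allGraphs (suc m)) ⟩
  ∑ (allGraphs (suc m)) total
    ≡⟨ ∑-comm (allGraphs (suc m)) (allFin (suc m)) (λ G x → ∣ 2 * deg G x - m ∣ ^ 4) ⟩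
  ∑ (allFin (suc m)) (λ x → ∑ (allGraphs (suc m)) (λ G → ∣ 2 * deg G x - m ∣ ^ 4))
    ≤⟨ ∑-≤-const (allFin (suc m)) _ (∑-deg-fourth-moment m) ⟩
  length (allFin (suc m)) * (3 * m * m * 2 ^ (suc m C 2))
    ≡⟨ cong (_* (3 * m * m * 2 ^ (suc m C 2))) (length-allFin (suc m)) ⟩
  suc m * (3 * m * m * 2 ^ (suc m C 2)) ∎
  where
  open ℕ.≤-Reasoning
  total : Graph (suc m) → ℕ
  total G = ∑ (allFin (suc m)) (λ x → ∣ 2 * deg G x - m ∣ ^ 4)
  far : ∀ G → ¬ Balanced m V G → (2 * V) ^ 4 ≤ total G
  far G unbal with Fin.¬∀⟶∃¬ (suc m) _ (λ x → inWindow? m V (deg G x)) unbal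
  ... | x , out = ℕ.≤-trans (ℕ.^-monoˡ-≤ 4 (outside-window-far m V (deg G x) out))
                            (∈⇒≤∑ (λ x → ∣ 2 * deg G x - m ∣ ^ 4) (∈-allFin (suc m) x))

-- Colour refinement to depth 2

mutual
  ≈ᶜ-refl : (c : Colour) → c ≈ᶜ c
  ≈ᶜ-refl one        = one≈
  ≈ᶜ-refl (col c cs) = col≈ (≈ᶜ-refl c) (Homogeneous.refl (≈ᶜ-pointwise-refl cs))

  ≈ᶜ-pointwise-refl : (cs : List Colour) → Pointwise _≈ᶜ_ cs cs
  ≈ᶜ-pointwise-refl []       = []
  ≈ᶜ-pointwise-refl (c ∷ cs) = ≈ᶜ-refl c ∷ ≈ᶜ-pointwise-refl cs

↭⇒multiset-≈ᶜ : {cs ds : List Colour} → cs ↭ ds → Homogeneous.Permutation _≈ᶜ_ cs ds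
↭⇒multiset-≈ᶜ cs↭ds = Homogeneous.map (λ { refl → ≈ᶜ-refl _ }) (↭⇒↭ₛ cs↭ds)

map-const : {X Y : Set} (y : Y) (xs : List X) → map (λ _ → y) xs ≡ replicate (length xs) y
map-const y []       = refl
map-const y (x ∷ xs) = cong (y ∷_) (map-const y xs)

degColour : ℕ → Colour
degColour d = col one (replicate d one)

nbrDegrees : {n : ℕ} → Graph n → Fin n → List ℕ
nbrDegrees G x = map (deg G) (nbrs G x)

CR1≡degColour : {n : ℕ} (G : Graph n) (y : Fin n) → CR 1 G y ≡ degColour (deg G y)
CR1≡degColour G y = cong (col one) (map-const one (nbrs G y))

CR2≡ : {n : ℕ} (G : Graph n) (x : Fin n) → CR 2 G x ≡ col (degColour (deg G x)) (map degColour (nbrDegrees G x))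
CR2≡ G x = cong₂ col (CR1≡degColour G x)
                     (trans (List.map-cong (CR1≡degColour G) (nbrs G x)) (List.map-∘ (nbrs G x)))

CR2-≈-from-nbrDegrees : {n : ℕ} (G H : Graph n) (x : Fin n) → nbrDegrees G x ↭ nbrDegrees H x → CR 2 G x ≈ᶜ CR 2 H x
CR2-≈-from-nbrDegrees G H x ds↭ = subst₂ _≈ᶜ_ (sym (CR2≡ G x)) (sym (CR2≡ H x))
  (col≈ (subst (λ d → degColour (deg G x) ≈ᶜ degColour d) same-deg (≈ᶜ-refl _))
        (↭⇒multiset-≈ᶜ (↭.map⁺ degColour ds↭)))
  where
  same-deg : deg G x ≡ deg H x
  same-deg = trans (sym (List.length-map (deg G) (nbrs G x)))
                   (trans (↭.↭-length ds↭) (List.length-map (deg H) (nbrs H x)))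

module Multiplicity {A : Set} (_≟_ : DecidableEquality A) where

  multiplicity : A → List A → ℕ
  multiplicity a xs = length (filter (a ≟_) xs)

  multiplicity-∷-cancel : (x : A) (xs ys : List A) (a : A) →
                          multiplicity a (x ∷ xs) ≡ multiplicity a (x ∷ ys) → multiplicity a xs ≡ multiplicity a ys
  multiplicity-∷-cancel x xs ys a eq with a ≟ x
  ... | yes _ = ℕ.suc-injective eq
  ... | no  _ = eq

  multiplicity-suc⇒∈ : (a : A) (xs : List A) {k : ℕ} → multiplicity a xs ≡ suc k → a ∈ xs
  multiplicity-suc⇒∈ a xs eq with filter (a ≟_) xs in filtered
  ... | z ∷ _ with ∈-filter⁻ (a ≟_) {xs = xs} (subst (z ∈_) (sym filtered) (here refl))
  ...   | z∈xs , refl = z∈xs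

  multiplicity-∉ : (a : A) (xs : List A) → a ∉ xs → multiplicity a xs ≡ 0
  multiplicity-∉ a xs a∉ =
    cong length (List.filter-none (a ≟_) (All.tabulate (λ x∈ a≡x → a∉ (subst (_∈ xs) (sym a≡x) x∈))))

  same-multiplicities⇒↭ : (xs ys : List A) → (∀ a → multiplicity a xs ≡ multiplicity a ys) → xs ↭ ys
  same-multiplicities⇒↭ []       []       _    = ↭-refl
  same-multiplicities⇒↭ []       (y ∷ ys) same with y ≟ y | same y
  ... | yes _   | ()
  ... | no  y≢y | _ = contradiction refl y≢y
  same-multiplicities⇒↭ (x ∷ xs) ys same
    with ∈-∃++ (multiplicity-suc⇒∈ x ys (trans (sym (same x)) (count-head x xs)))
    where
    count-head : ∀ x xs → multiplicity x (x ∷ xs) ≡ suc (multiplicity x xs)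
    count-head x xs with x ≟ x
    ... | yes _   = refl
    ... | no  x≢x = contradiction refl x≢x
  ... | us , vs , refl = ↭-trans (↭-prep x (same-multiplicities⇒↭ xs (us ++ vs) same′)) (↭-sym (↭.shift x us vs))
    where
    same′ : ∀ a → multiplicity a xs ≡ multiplicity a (us ++ vs)
    same′ a = multiplicity-∷-cancel x xs (us ++ vs) a
                (trans (same a) (↭.↭-length (↭.filter-↭ (a ≟_) (↭.shift x us vs))))

-- Relabelings

fromAdj : {n : ℕ} → (Fin n → Fin n → Bool) → Graph n
fromAdj {zero}  A = tt
fromAdj {suc n} A = tabulate (λ j → A zero (suc j)) , fromAdj (λ i j → A (suc i) (suc j))

fromAdj-cong : {n : ℕ} {A B : Fin n → Fin n → Bool} → (∀ i j → A i j ≡ B i j) → fromAdj A ≡ fromAdj B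
fromAdj-cong {zero}  A≗B = refl
fromAdj-cong {suc n} A≗B = cong₂ _,_ (tabulate-cong (λ j → A≗B zero (suc j))) (fromAdj-cong (λ i j → A≗B (suc i) (suc j)))

fromAdj∘adj : {n : ℕ} (G : Graph n) → fromAdj (adj G) ≡ G
fromAdj∘adj {zero}  tt      = refl
fromAdj∘adj {suc n} (r , g) = cong₂ _,_ (tabulate∘lookup r) (fromAdj∘adj g)

relabel : {n : ℕ} → Vec (Fin n) n → Graph n → Graph n
relabel v H = fromAdj (λ i j → adj H (lookup v i) (lookup v j))

relabelings : {n : ℕ} → Graph n → List (Graph n)
relabelings {n} H = map (λ v → relabel v H) (allVecs (allFin n) n)

length-relabelings : {n : ℕ} (H : Graph n) → length (relabelings H) ≡ n ^ n
length-relabelings {n} H = begin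
  length (relabelings H)              ≡⟨ List.length-map (λ v → relabel v H) (allVecs (allFin n) n) ⟩
  length (allVecs (allFin n) n)       ≡⟨ length-allVecs (allFin n) n ⟩
  length (allFin n) ^ n               ≡⟨ cong (_^ n) (length-allFin n) ⟩
  n ^ n                               ∎
  where open ≡-Reasoning

≅⇒∈-relabelings : {n : ℕ} {G H : Graph n} → G ≅ H → G ∈ relabelings H
≅⇒∈-relabelings {n} {G} {H} (π , adj-eq) =
  subst (_∈ relabelings H) (sym G≡) (∈-map⁺ (λ v → relabel v H) (∈-allVecs (allFin n) v (λ i → ∈-allFin n _)))
  where
  v = tabulate (π ⟨$⟩ʳ_)
  G≡ : G ≡ relabel v H
  G≡ = trans (sym (fromAdj∘adj G)) (fromAdj-cong (λ i j → trans (adj-eq i j)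
         (sym (cong₂ (adj H) (lookup∘tabulate (π ⟨$⟩ʳ_) i) (lookup∘tabulate (π ⟨$⟩ʳ_) j)))))

witnessRelabelings : {n : ℕ} {P : Pred (Graph n) 0ℓ} {Gs : List (Graph n)} → Dec (Any P Gs) → List (Graph n)
witnessRelabelings (yes p) = relabelings (proj₁ (satisfied p))
witnessRelabelings (no _)  = []

length-witnessRelabelings : {n : ℕ} {P : Pred (Graph n) 0ℓ} {Gs : List (Graph n)} (p? : Dec (Any P Gs)) →
                            length (witnessRelabelings p?) ≤ n ^ n
length-witnessRelabelings (yes p) = ℕ.≤-reflexive (length-relabelings (proj₁ (satisfied p)))
length-witnessRelabelings (no _)  = z≤n

∉-witnessRelabelings : {n : ℕ} {P : Pred (Graph n) 0ℓ} {Gs : List (Graph n)} (p? : Dec (Any P Gs)) {G : Graph n} →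
                       G ∈ Gs → P G → G ∉ witnessRelabelings p? → ∃[ H ] P H × ¬ G ≅ H
∉-witnessRelabelings (yes p) G∈ PG G∉ = proj₁ (satisfied p) , proj₂ (satisfied p) , λ G≅H → G∉ (≅⇒∈-relabelings G≅H)
∉-witnessRelabelings (no ¬p) G∈ PG G∉ = contradiction (lose G∈ PG) ¬p

nonisomorphic-twins : {n : ℕ} {D : Set} (_≟_ : DecidableEquality D) (φ : Graph n → D)
                      {Q : Pred (Graph n) 0ℓ} (Q? : Decidable Q) (ds : List D) →
                      ∃[ L ] (length L ≤ length ds * n ^ n
                             × (∀ G → Q G → φ G ∈ ds → G ∉ L → ∃[ H ] (Q H × φ H ≡ φ G) × ¬ G ≅ H))
nonisomorphic-twins {n} {D} _≟_ φ {Q} Q? ds = L , length-L , twin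
  where
  fibre? : (d : D) → Decidable (λ H → Q H × φ H ≡ d)
  fibre? d H = Q? H ×-dec (φ H ≟ d)
  relabelingsFor : D → List (Graph n)
  relabelingsFor d = witnessRelabelings (any? (fibre? d) (allGraphs n))
  L = concatMap relabelingsFor ds
  length-L : length L ≤ length ds * n ^ n
  length-L = ℕ.≤-trans (ℕ.≤-reflexive (length-concatMap relabelingsFor ds))
                       (∑-≤-const ds (n ^ n) (λ d → length-witnessRelabelings (any? (fibre? d) (allGraphs n))))
  twin : ∀ G → Q G → φ G ∈ ds → G ∉ L → ∃[ H ] (Q H × φ H ≡ φ G) × ¬ G ≅ H
  twin G QG φG∈ G∉ = ∉-witnessRelabelings (any? (fibre? (φ G)) (allGraphs n)) (∈-allGraphs G) (QG , refl)
                       (λ G∈ → G∉ (∈-concat⁺′ G∈ (∈-map⁺ relabelingsFor φG∈)))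

open Multiplicity ℕ._≟_ using (multiplicity; multiplicity-∉; same-multiplicities⇒↭)

-- Profiles

Profile : ℕ → ℕ → Set
Profile m V = Vec (Vec ℕ (windowWidth V)) (suc m)

profileRow : (m V : ℕ) → Graph (suc m) → Fin (suc m) → Vec ℕ (windowWidth V)
profileRow m V G x = tabulate (λ j → multiplicity (windowStart m V + toℕ j) (nbrDegrees G x))

profile : (m V : ℕ) → Graph (suc m) → Profile m V
profile m V G = tabulate (profileRow m V G)

profile-entry : (m V : ℕ) (G : Graph (suc m)) (x : Fin (suc m)) (j : Fin (windowWidth V)) →
                lookup (lookup (profile m V G) x) j ≡ multiplicity (windowStart m V + toℕ j) (nbrDegrees G x)
profile-entry m V G x j =
  trans (cong (λ row → lookup row j) (lookup∘tabulate (profileRow m V G) x))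
        (lookup∘tabulate (λ j → multiplicity (windowStart m V + toℕ j) (nbrDegrees G x)) j)

window-index : (m V d : ℕ) → InWindow m V d → ∃[ j ] windowStart m V + toℕ {windowWidth V} j ≡ d
window-index m V d (lo≤d , d<end) = fromℕ< offset<width , trans (cong (lo +_) (Fin.toℕ-fromℕ< offset<width)) (ℕ.m+[n∸m]≡n lo≤d)
  where
  lo = windowStart m V
  offset<width : d ∸ lo < windowWidth V
  offset<width = ℕ.+-cancelˡ-< lo (d ∸ lo) (windowWidth V) (subst (_< lo + windowWidth V) (sym (ℕ.m+[n∸m]≡n lo≤d)) d<end)

nbrDegree-in-window : {m V : ℕ} {G : Graph (suc m)} → Balanced m V G → ∀ {x d} → d ∈ nbrDegrees G x → InWindow m V d
nbrDegree-in-window {G = G} balanced d∈ with ∈-map⁻ (deg G) d∈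
... | y , _ , refl = balanced y

same-profile⇒same-multiplicities : (m V : ℕ) {G H : Graph (suc m)} → Balanced m V G → Balanced m V H →
  profile m V G ≡ profile m V H → ∀ x d → multiplicity d (nbrDegrees G x) ≡ multiplicity d (nbrDegrees H x)
same-profile⇒same-multiplicities m V {G} {H} balG balH same x d with inWindow? m V d
... | no out = trans (multiplicity-∉ d _ (out ∘ nbrDegree-in-window {m} {V} {G} balG {x}))
                     (sym (multiplicity-∉ d _ (out ∘ nbrDegree-in-window {m} {V} {H} balH {x})))
... | yes inside with window-index m V d inside
...   | j , refl = trans (sym (profile-entry m V G x j))
                         (trans (cong (λ P → lookup (lookup P x) j) same) (profile-entry m V H x j))

profiles : (m V : ℕ) → List (Profile m V)
profiles m V = allVecs (allVecs (upTo (suc (suc m))) (windowWidth V)) (suc m)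

length-profiles : (m V : ℕ) → length (profiles m V) ≡ (suc (suc m) ^ windowWidth V) ^ suc m
length-profiles m V = begin
  length (profiles m V)
    ≡⟨ length-allVecs (allVecs (upTo (suc (suc m))) (windowWidth V)) (suc m) ⟩
  length (allVecs (upTo (suc (suc m))) (windowWidth V)) ^ suc m
    ≡⟨ cong (_^ suc m) (length-allVecs (upTo (suc (suc m))) (windowWidth V)) ⟩
  (length (upTo (suc (suc m))) ^ windowWidth V) ^ suc m
    ≡⟨ cong (λ l → (l ^ windowWidth V) ^ suc m) (List.length-upTo (suc (suc m))) ⟩
  (suc (suc m) ^ windowWidth V) ^ suc m ∎
  where open ≡-Reasoning

multiplicity≤ : {n : ℕ} (G : Graph n) (x : Fin n) (d : ℕ) → multiplicity d (nbrDegrees G x) ≤ n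
multiplicity≤ {n} G x d = begin
  multiplicity d (nbrDegrees G x) ≤⟨ List.length-filter (d ℕ.≟_) (nbrDegrees G x) ⟩
  length (nbrDegrees G x)         ≡⟨ List.length-map (deg G) (nbrs G x) ⟩
  length (nbrs G x)               ≤⟨ List.length-filter (λ w → T? (adj G x w)) (allFin n) ⟩
  length (allFin n)               ≡⟨ length-allFin n ⟩
  n                               ∎
  where open ℕ.≤-Reasoning

∈-profiles : (m V : ℕ) (G : Graph (suc m)) → profile m V G ∈ profiles m V
∈-profiles m V G = ∈-allVecs _ (profile m V G) (λ x →
  subst (_∈ allVecs (upTo (suc (suc m))) (windowWidth V)) (sym (lookup∘tabulate (profileRow m V G) x))
        (∈-allVecs _ (profileRow m V G x) (λ j → subst (_∈ upTo (suc (suc m))) (sym (lookup∘tabulate _ j))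
                                                        (∈-upTo⁺ (s≤s (multiplicity≤ G x _))))))

exceptional-graphs : (m V : ℕ) →
  ∃[ L ] ((∀ (G : Graph (suc m)) → G ∉ L → Property G)
         × length L ≤ length (unbalanced m V) + (suc (suc m) ^ windowWidth V) ^ suc m * suc m ^ suc m)
exceptional-graphs m V = unbalanced m V ++ twins , property , length-L
  where
  twins-spec = nonisomorphic-twins (Vec.≡-dec (Vec.≡-dec ℕ._≟_)) (profile m V) (balanced? m V) (profiles m V)
  twins = proj₁ twins-spec
  property : ∀ G → G ∉ unbalanced m V ++ twins → Property G
  property G G∉ with balanced? m V G
  ... | no unbal = contradiction (∈-++⁺ˡ (∈-filter⁺ (λ G → ¬? (balanced? m V G)) (∈-allGraphs G) unbal)) G∉
  ... | yes balG with proj₂ (proj₂ twins-spec) G balG (∈-profiles m V G) (G∉ ∘ ∈-++⁺ʳ (unbalanced m V))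
  ...   | H , (balH , same) , G≇H = H , G≇H , λ x →
          CR2-≈-from-nbrDegrees G H x (same-multiplicities⇒↭ _ _ (same-profile⇒same-multiplicities m V balG balH (sym same) x))
  length-L : length (unbalanced m V ++ twins) ≤ length (unbalanced m V) + (suc (suc m) ^ windowWidth V) ^ suc m * suc m ^ suc m
  length-L = begin
    length (unbalanced m V ++ twins)                ≡⟨ List.length-++ (unbalanced m V) ⟩
    length (unbalanced m V) + length twins          ≤⟨ ℕ.+-monoʳ-≤ (length (unbalanced m V)) (proj₁ (proj₂ twins-spec)) ⟩
    length (unbalanced m V) + length (profiles m V) * suc m ^ suc m
      ≡⟨ cong (λ l → length (unbalanced m V) + l * suc m ^ suc m) (length-profiles m V) ⟩
    length (unbalanced m V) + (suc (suc m) ^ windowWidth V) ^ suc m * suc m ^ suc m ∎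
    where open ℕ.≤-Reasoning

-- Choice of parameters

n<2^n : (n : ℕ) → n < 2 ^ n
n<2^n zero    = s≤s z≤n
n<2^n (suc n) = ℕ.+-mono-≤ (ℕ.m^n>0 2 n) (ℕ.≤-trans (n<2^n n) (ℕ.≤-reflexive (sym (ℕ.+-identityʳ (2 ^ n)))))

log₂-bracket : (n : ℕ) → 1 ≤ n → ∃[ ℓ ] (2 ^ ℓ ≤ n × n < 2 ^ suc ℓ)
log₂-bracket (suc zero)    _ = 0 , s≤s z≤n , s≤s (s≤s z≤n)
log₂-bracket (suc (suc n)) _ with log₂-bracket (suc n) (s≤s z≤n)
... | ℓ , lower , upper with suc (suc n) <? 2 ^ suc ℓ
...   | yes below = ℓ , ℕ.m≤n⇒m≤1+n lower , below
...   | no  above = suc ℓ , ℕ.≤-reflexive (sym n+2≡2^[ℓ+1]) ,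
                    subst (_< 2 ^ suc (suc ℓ)) (sym n+2≡2^[ℓ+1]) (ℕ.^-monoʳ-< 2 (s≤s (s≤s z≤n)) (ℕ.n<1+n (suc ℓ)))
  where
  n+2≡2^[ℓ+1] : suc (suc n) ≡ 2 ^ suc ℓ
  n+2≡2^[ℓ+1] = ℕ.≤-antisym upper (ℕ.≮⇒≥ above)

^-distribʳ-* : (a b n : ℕ) → (a * b) ^ n ≡ a ^ n * b ^ n
^-distribʳ-* a b zero    = refl
^-distribʳ-* a b (suc n) = trans (cong (a * b *_) (^-distribʳ-* a b n)) (ℕ*.interchange a b (a ^ n) (b ^ n))

pow5-below-exp : (ℓ : ℕ) → suc ℓ ^ 5 ≤ 7 ^ 5 * 2 ^ ℓ
pow5-below-exp ℓ with ℓ ≤? 6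
... | yes ℓ≤6 = ℕ.≤-trans (ℕ.^-monoˡ-≤ 5 (s≤s ℓ≤6)) (ℕ.m≤m*n (7 ^ 5) (2 ^ ℓ) {{ℕ.m^n≢0 2 ℓ}})
... | no  ℓ≰6 = subst (λ ℓ → suc ℓ ^ 5 ≤ 7 ^ 5 * 2 ^ ℓ) (ℕ.m+[n∸m]≡n (ℕ.<⇒≤ (ℕ.≰⇒> ℓ≰6))) (from-6 (ℓ ∸ 6))
  where
  step : ∀ t → (8 + t) ^ 5 ≤ 2 * (7 + t) ^ 5
  step t = ℕ.≤-trans (ℕ.m≤m+n _ _) (ℕ.≤-reflexive (expand t))
    where
    -- (8/7)^5 < 2: the difference is a polynomial in t with nonnegative coefficients
    expand : ∀ t → (8 + t) * ((8 + t) * ((8 + t) * ((8 + t) * ((8 + t) * 1))))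
                   + (t * t * t * t * t + 30 * (t * t * t * t) + 340 * (t * t * t) + 1740 * (t * t) + 3530 * t + 846)
                 ≡ 2 * ((7 + t) * ((7 + t) * ((7 + t) * ((7 + t) * ((7 + t) * 1)))))
    expand = ℕ-Ring.solve-∀
  from-6 : ∀ t → (7 + t) ^ 5 ≤ 7 ^ 5 * 2 ^ (6 + t)
  from-6 zero    = ℕ.m≤m*n (7 ^ 5) (2 ^ 6)
  from-6 (suc t) = begin
    (8 + t) ^ 5               ≤⟨ step t ⟩
    2 * (7 + t) ^ 5           ≤⟨ ℕ.*-monoʳ-≤ 2 (from-6 t) ⟩
    2 * (7 ^ 5 * 2 ^ (6 + t)) ≡⟨ ℕ*.x∙yz≈y∙xz 2 (7 ^ 5) (2 ^ (6 + t)) ⟩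
    7 ^ 5 * 2 ^ (7 + t)       ∎
    where open ℕ.≤-Reasoning

poly-below-exp : (c ℓ : ℕ) → c * 7 ^ 5 ≤ suc ℓ → c * suc ℓ ^ 4 ≤ 2 ^ ℓ
poly-below-exp c ℓ c≤ = ℕ.*-cancelˡ-≤ (7 ^ 5) (begin
  7 ^ 5 * (c * suc ℓ ^ 4) ≡⟨ ℕ*.x∙yz≈yx∙z (7 ^ 5) c (suc ℓ ^ 4) ⟩
  c * 7 ^ 5 * suc ℓ ^ 4   ≤⟨ ℕ.*-monoˡ-≤ (suc ℓ ^ 4) c≤ ⟩
  suc ℓ ^ 5               ≤⟨ pow5-below-exp ℓ ⟩
  7 ^ 5 * 2 ^ ℓ           ∎)
  where open ℕ.≤-Reasoning

2*[1+m]C2≡[1+m]*m : (m : ℕ) → 2 * (suc m C 2) ≡ suc m * m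
2*[1+m]C2≡[1+m]*m zero    = refl
2*[1+m]C2≡[1+m]*m (suc m) = begin
  2 * (suc (suc m) C 2)         ≡⟨ cong (2 *_) (suc-C-2 (suc m)) ⟩
  2 * (suc m + suc m C 2)       ≡⟨ ℕ.*-distribˡ-+ 2 (suc m) _ ⟩
  2 * suc m + 2 * (suc m C 2)   ≡⟨ cong (2 * suc m +_) (2*[1+m]C2≡[1+m]*m m) ⟩
  2 * suc m + suc m * m         ≡⟨ regroup m ⟩
  suc (suc m) * suc m           ∎
  where
  open ≡-Reasoning
  regroup : ∀ m → 2 * suc m + suc m * m ≡ suc (suc m) * suc m
  regroup = ℕ-Ring.solve-∀

module Parameters (k m ℓ : ℕ) where

  n s V : ℕ
  n = suc m
  s = suc ℓ
  V = suc (n / (8 * s))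

  n≤8sV : n ≤ 8 * s * V
  n≤8sV = begin
    n                                   ≡⟨ m≡m%n+[m/n]*n n (8 * s) ⟩
    n % (8 * s) + n / (8 * s) * (8 * s) ≤⟨ ℕ.+-monoˡ-≤ _ (ℕ.<⇒≤ (m%n<n n (8 * s))) ⟩
    8 * s + n / (8 * s) * (8 * s)       ≡⟨ cong (8 * s +_) (ℕ.*-comm (n / (8 * s)) (8 * s)) ⟩
    8 * s + 8 * s * (n / (8 * s))       ≡⟨ sym (ℕ.*-suc (8 * s) (n / (8 * s))) ⟩
    8 * s * V                           ∎
    where open ℕ.≤-Reasoning

  V⁴-large : k * (8 * s) ^ 4 ≤ n → k * n * n * n ≤ V ^ 4
  V⁴-large k[8s]⁴≤n = ℕ.*-cancelˡ-≤ ((8 * s) ^ 4) {{ℕ.m^n≢0 (8 * s) 4}} (begin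
    (8 * s) ^ 4 * (k * n * n * n)   ≡⟨ regroup ((8 * s) ^ 4) k n ⟩
    k * (8 * s) ^ 4 * (n * n * n)   ≤⟨ ℕ.*-monoˡ-≤ (n * n * n) k[8s]⁴≤n ⟩
    n * (n * n * n)                 ≡⟨ fourth n ⟩
    n ^ 4                           ≤⟨ ℕ.^-monoˡ-≤ 4 n≤8sV ⟩
    (8 * s * V) ^ 4                 ≡⟨ ^-distribʳ-* (8 * s) V 4 ⟩
    (8 * s) ^ 4 * V ^ 4             ∎)
    where
    open ℕ.≤-Reasoning
    regroup : ∀ x k n → x * (k * n * n * n) ≡ k * x * (n * n * n)
    regroup = ℕ-Ring.solve-∀
    fourth : ∀ n → n * (n * n * n) ≡ n * (n * (n * (n * 1)))
    fourth = ℕ-Ring.solve-∀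

  unbalanced-rare : k * (8 * s) ^ 4 ≤ n → 2 * k * length (unbalanced m V) ≤ 2 ^ (n C 2)
  unbalanced-rare k[8s]⁴≤n = ℕ.*-cancelʳ-≤ (2 * k * u) (2 ^ (n C 2)) ((2 * V) ^ 4) {{ℕ.m^n≢0 (2 * V) 4}} (begin
    2 * k * u * (2 * V) ^ 4                ≡⟨ ℕ.*-assoc (2 * k) u _ ⟩
    2 * k * (u * (2 * V) ^ 4)              ≤⟨ ℕ.*-monoʳ-≤ (2 * k) (length-unbalanced m V) ⟩
    2 * k * (n * (3 * m * m * 2 ^ (n C 2))) ≡⟨ regroup (2 * k) n (3 * m * m) (2 ^ (n C 2)) ⟩
    2 * k * (n * (3 * m * m)) * 2 ^ (n C 2) ≤⟨ ℕ.*-monoˡ-≤ (2 ^ (n C 2)) coefficient ⟩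
    (2 * V) ^ 4 * 2 ^ (n C 2)              ≡⟨ ℕ.*-comm ((2 * V) ^ 4) _ ⟩
    2 ^ (n C 2) * (2 * V) ^ 4              ∎)
    where
    open ℕ.≤-Reasoning
    u = length (unbalanced m V)
    regroup : ∀ x y z w → x * (y * (z * w)) ≡ x * (y * z) * w
    regroup = ℕ-Ring.solve-∀
    six : ∀ k n m → 2 * k * (n * (3 * m * m)) ≡ 6 * (k * n * m * m)
    six = ℕ-Ring.solve-∀
    coefficient : 2 * k * (n * (3 * m * m)) ≤ (2 * V) ^ 4
    coefficient = begin
      2 * k * (n * (3 * m * m)) ≡⟨ six k n m ⟩
      6 * (k * n * m * m)       ≤⟨ ℕ.*-monoʳ-≤ 6 (ℕ.*-mono-≤ (ℕ.*-monoʳ-≤ (k * n) (ℕ.n≤1+n m)) (ℕ.n≤1+n m)) ⟩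
      6 * (k * n * n * n)       ≤⟨ ℕ.*-monoʳ-≤ 6 (V⁴-large k[8s]⁴≤n) ⟩
      6 * V ^ 4                 ≤⟨ ℕ.*-monoˡ-≤ (V ^ 4) (ℕ.m≤m+n 6 10) ⟩
      2 ^ 4 * V ^ 4             ≡⟨ sym (^-distribʳ-* 2 V 4) ⟩
      (2 * V) ^ 4               ∎

  exponent-bound : 8 * k + 20 * s + 2 ≤ n → 2 * k + (s * windowWidth V * n + s * n) ≤ n C 2
  exponent-bound small = ℕ.*-cancelˡ-≤ 4 (begin
    4 * (2 * k + (s * windowWidth V * n + s * n))  ≡⟨ expand k s a n ⟩
    8 * k + a * (8 * s) * n + 20 * s * n           ≤⟨ ℕ.+-monoˡ-≤ (20 * s * n) (ℕ.+-monoʳ-≤ (8 * k) (ℕ.*-monoˡ-≤ n (m/n*n≤m n (8 * s)))) ⟩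
    8 * k + n * n + 20 * s * n                     ≤⟨ ℕ.+-cancelʳ-≤ (2 * n) _ _ key ⟩
    2 * (n * m)                                    ≡⟨ cong (2 *_) (sym (2*[1+m]C2≡[1+m]*m m)) ⟩
    2 * (2 * (n C 2))                              ≡⟨ sym (ℕ.*-assoc 2 2 (n C 2)) ⟩
    4 * (n C 2)                                    ∎)
    where
    open ℕ.≤-Reasoning
    a = n / (8 * s)
    expand : ∀ x y z w → 4 * (2 * x + (y * (2 * suc z + 2) * w + y * w)) ≡ 8 * x + z * (8 * y) * w + 20 * y * w
    expand = ℕ-Ring.solve-∀
    collect : ∀ x y z w → 8 * x * w + z + 20 * y * w + 2 * w ≡ (8 * x + 20 * y + 2) * w + z
    collect = ℕ-Ring.solve-∀
    double : ∀ m → suc m * suc m + suc m * suc m ≡ 2 * (suc m * m) + 2 * suc m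
    double = ℕ-Ring.solve-∀
    key : 8 * k + n * n + 20 * s * n + 2 * n ≤ 2 * (n * m) + 2 * n
    key = begin
      8 * k + n * n + 20 * s * n + 2 * n     ≤⟨ ℕ.+-monoˡ-≤ (2 * n) (ℕ.+-monoˡ-≤ (20 * s * n) (ℕ.+-monoˡ-≤ (n * n) (ℕ.m≤m*n (8 * k) n))) ⟩
      8 * k * n + n * n + 20 * s * n + 2 * n ≡⟨ collect k s (n * n) n ⟩
      (8 * k + 20 * s + 2) * n + n * n       ≤⟨ ℕ.+-monoˡ-≤ (n * n) (ℕ.*-monoˡ-≤ n small) ⟩
      n * n + n * n                          ≡⟨ double m ⟩
      2 * (n * m) + 2 * n                    ∎

  profiles-rare : 8 * k + 20 * s + 2 ≤ n → n < 2 ^ s →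
                  2 * k * ((suc n ^ windowWidth V) ^ n * n ^ n) ≤ 2 ^ (n C 2)
  profiles-rare small n<2^s = begin
    2 * k * ((suc n ^ K) ^ n * n ^ n)                 ≤⟨ ℕ.*-mono-≤ (ℕ.<⇒≤ (n<2^n (2 * k))) (ℕ.*-mono-≤ entries vertices) ⟩
    2 ^ (2 * k) * (2 ^ (s * K * n) * 2 ^ (s * n))     ≡⟨ cong (2 ^ (2 * k) *_) (sym (ℕ.^-distribˡ-+-* 2 (s * K * n) (s * n))) ⟩
    2 ^ (2 * k) * 2 ^ (s * K * n + s * n)             ≡⟨ sym (ℕ.^-distribˡ-+-* 2 (2 * k) _) ⟩
    2 ^ (2 * k + (s * K * n + s * n))                 ≤⟨ ℕ.^-monoʳ-≤ 2 (exponent-bound small) ⟩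
    2 ^ (n C 2)                                       ∎
    where
    open ℕ.≤-Reasoning
    K = windowWidth V
    entries : (suc n ^ K) ^ n ≤ 2 ^ (s * K * n)
    entries = ℕ.≤-trans (ℕ.^-monoˡ-≤ n (ℕ.^-monoˡ-≤ K n<2^s))
                        (ℕ.≤-reflexive (trans (cong (_^ n) (ℕ.^-*-assoc 2 s K)) (ℕ.^-*-assoc 2 (s * K) n)))
    vertices : n ^ n ≤ 2 ^ (s * n)
    vertices = ℕ.≤-trans (ℕ.^-monoˡ-≤ n (ℕ.<⇒≤ n<2^s)) (ℕ.≤-reflexive (ℕ.^-*-assoc 2 s n))

  exceptional-rare : 4096 * suc k * suc ℓ ^ 4 ≤ suc m → suc m < 2 ^ suc ℓ →
                     ∃[ L ] (((G : Graph (suc m)) → G ∉ L → Property G) × k * length L ≤ 2 ^ (suc m C 2))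
  exceptional-rare large n<2^s with exceptional-graphs m V
  ... | L , property , length-L = L , property , ℕ.*-cancelˡ-≤ 2 (begin
    2 * (k * length L)                     ≤⟨ ℕ.*-monoʳ-≤ 2 (ℕ.*-monoʳ-≤ k length-L) ⟩
    2 * (k * (u + r))                      ≡⟨ distribute k u r ⟩
    2 * k * u + 2 * k * r                  ≤⟨ ℕ.+-mono-≤ (unbalanced-rare k[8s]⁴≤n) (profiles-rare small n<2^s) ⟩
    2 ^ (n C 2) + 2 ^ (n C 2)              ≡⟨ cong (2 ^ (n C 2) +_) (sym (ℕ.+-identityʳ _)) ⟩
    2 * 2 ^ (n C 2)                        ∎)
    where
    open ℕ.≤-Reasoning
    u = length (unbalanced m V)
    r = (suc n ^ windowWidth V) ^ n * n ^ n
    distribute : ∀ k u r → 2 * (k * (u + r)) ≡ 2 * k * u + 2 * k * r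
    distribute = ℕ-Ring.solve-∀
    k[8s]⁴≤n : k * (8 * s) ^ 4 ≤ n
    k[8s]⁴≤n = begin
      k * (8 * s) ^ 4       ≡⟨ cong (k *_) (^-distribʳ-* 8 s 4) ⟩
      k * (4096 * s ^ 4)    ≡⟨ sym (ℕ.*-assoc k 4096 (s ^ 4)) ⟩
      k * 4096 * s ^ 4      ≤⟨ ℕ.*-monoˡ-≤ (s ^ 4) (ℕ.≤-trans (ℕ.≤-reflexive (ℕ.*-comm k 4096)) (ℕ.*-monoʳ-≤ 4096 (ℕ.n≤1+n k))) ⟩
      4096 * suc k * s ^ 4  ≤⟨ large ⟩
      n                     ∎
    22≤4096 : 22 ≤ 4096
    22≤4096 = ℕ.m≤m+n 22 4074
    linear : ∀ k ℓ → 8 * k + 20 * suc ℓ + 2 + (14 * k + 2 * ℓ + 22 * k * ℓ) ≡ 22 * suc k * suc ℓ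
    linear = ℕ-Ring.solve-∀
    small : 8 * k + 20 * s + 2 ≤ n
    small = begin
      8 * k + 20 * s + 2    ≤⟨ ℕ.m≤m+n _ _ ⟩
      _                     ≡⟨ linear k ℓ ⟩
      22 * suc k * s        ≤⟨ ℕ.*-monoˡ-≤ s (ℕ.*-monoˡ-≤ (suc k) 22≤4096) ⟩
      4096 * suc k * s      ≤⟨ ℕ.*-monoʳ-≤ (4096 * suc k) (ℕ.m≤m*n s (s ^ 3) {{ℕ.m^n≢0 s 3}}) ⟩
      4096 * suc k * s ^ 4  ≤⟨ large ⟩
      n                     ∎

2^a≤n<2^b⇒a<b : (a b : ℕ) {n : ℕ} → 2 ^ a ≤ n → n < 2 ^ b → a < b
2^a≤n<2^b⇒a<b a b 2^a≤n n<2^b = ℕ.≰⇒> (λ b≤a → ℕ.<-irrefl refl (ℕ.<-≤-trans n<2^b (ℕ.≤-trans (ℕ.^-monoʳ-≤ 2 b≤a) 2^a≤n)))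

lemma6p2 : (k : ℕ) → ∃[ N ] ((n : ℕ) → N ≤ n →
             ∃[ L ] (((G : Graph n) → G ∉ L → Property G)
                    × k * length L ≤ 2 ^ (n C 2)))
-- Beyond N, 4096 (k + 1) (⌊log₂ n⌋ + 1)⁴ ≤ n, which is what the parameters need.
lemma6p2 k = 2 ^ (4096 * suc k * 7 ^ 5) , exceptional-rare-beyond
  where
  exceptional-rare-beyond : (n : ℕ) → 2 ^ (4096 * suc k * 7 ^ 5) ≤ n →
    ∃[ L ] (((G : Graph n) → G ∉ L → Property G) × k * length L ≤ 2 ^ (n C 2))
  exceptional-rare-beyond zero    2^c₀≤0 = contradiction 2^c₀≤0 (ℕ.<⇒≱ (ℕ.m^n>0 2 (4096 * suc k * 7 ^ 5)))
  exceptional-rare-beyond (suc m) 2^c₀≤n =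
    let ℓ , 2^ℓ≤n , n<2^[ℓ+1] = log₂-bracket (suc m) (s≤s z≤n)
    in Parameters.exceptional-rare k m ℓ
         (ℕ.≤-trans (poly-below-exp (4096 * suc k) ℓ (ℕ.<⇒≤ (2^a≤n<2^b⇒a<b (4096 * suc k * 7 ^ 5) (suc ℓ) 2^c₀≤n n<2^[ℓ+1]))) 2^ℓ≤n) n<2^[ℓ+1]
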